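{- Let $k$ be an integer and let $d$ be sufficiently large. Let $Q=(V,E)$ be a component of $Q_{d,k}$. Then $$\min_{A\subseteq V:\,1\le|A|\le|V|/2}|E(A,V\setminus A)|=\binom dk.$$
   Context: $Q_{d,k}$ is the graph on $\{0,1\}^d$ in which two vertices are adjacent iff their Hamming distance is exactly $k$. A component of $Q_{d,k}$ is: $Q_{d,k}$ itself if $k$ is odd; if $k$ is even, the subgraph induced by the vertices of even Hamming weight or by those of odd Hamming weight. $E(A,V\setminus A)$ is the set of edges of $Q$ with exactly one endpoint in $A$. -}

module Defs where

open import Data.Bool using (Bool; true; false; _∧_; not; if_then_else_; _xor_)
open import Data.Bool.Properties using () renaming (_≟_ to _≟B_)
open import Data.Nat using (ℕ; zero; suc; _+_; _*_; _≡ᵇ_; _%_)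
open import Data.Vec using (Vec; []; _∷_)
open import Data.List using (List; []; _∷_; map; concatMap; length; filter)
open import Data.Product using (_×_; Σ; _,_)
open import Data.Sum using (_⊎_)
open import Relation.Binary.PropositionalEquality using (_≡_)

Vertex : ℕ → Set
Vertex d = Vec Bool d

hamming : ∀ {d} → Vertex d → Vertex d → ℕ
hamming [] [] = 0
hamming (x ∷ xs) (y ∷ ys) = (if x xor y then 1 else 0) + hamming xs ys

parity : ∀ {d} → Vertex d → Bool
parity [] = false
parity (x ∷ xs) = x xor parity xs

allVertices : (d : ℕ) → List (Vertex d)
allVertices zero = [] ∷ []
allVertices (suc d) = map (true ∷_) (allVertices d) Data.List.++ map (false ∷_) (allVertices d)

Subset : ℕ → Set
Subset d = Vertex d → Bool

size : ∀ {d} → Subset d → ℕ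
size {d} S = length (filter (λ v → S v ≟B true) (allVertices d))

adjᵇ : ∀ {d} → ℕ → Vertex d → Vertex d → Bool
adjᵇ k u v = hamming u v ≡ᵇ k

-- |E(A, V \ A)| in the component with vertex set V of Q_{d,k}:
-- number of pairs (u,v) with u ∈ A, v ∈ V \ A and u,v adjacent.
-- (A ⊆ V is assumed separately; each edge of the cut is counted once.)
cutSize : ∀ {d} → ℕ → (V A : Subset d) → ℕ
cutSize {d} k V A =
  length (filter (λ p → (A (Data.Product.proj₁ p) ∧ (V (Data.Product.proj₂ p) ∧ (not (A (Data.Product.proj₂ p)) ∧ adjᵇ k (Data.Product.proj₁ p) (Data.Product.proj₂ p)))) ≟B true)
    (concatMap (λ u → map (λ v → (u , v)) (allVertices d)) (allVertices d)))

-- V is (the vertex set of) a component of Q_{d,k}: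
-- k odd: all of {0,1}^d; k even: the even-weight class or the odd-weight class.
IsComponent : (d k : ℕ) → Subset d → Set
IsComponent d k V =
  (k % 2 ≡ 1 × (∀ v → V v ≡ true))
  ⊎ (k % 2 ≡ 0 × Σ Bool (λ b → ∀ v → V v ≡ (if b then parity v else not (parity v))))

_⊆_ : ∀ {d} → Subset d → Subset d → Set
A ⊆ B = ∀ v → A v ≡ true → B v ≡ true

module Submission where

-- Let A ⊆ V and let H be the group of translations h with A + h = A.  If a
-- weight-k vector s is not in H, some x ∈ A has x + s ∉ A, and then x + h,
-- x + h + s is a cut edge for every h ∈ H: that is |H| cut edges in the
-- direction s.  So if b weight-k vectors lie outside H and g inside, the cut
-- has at least b |H| ≥ b (g + 1) ≥ g + b = C(d,k) edges, since 0 ∈ H as well.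
-- If b = 0, H contains every weight-k vector.  For d > k every weight-2
-- vector is a sum of two weight-k vectors, so H contains all even vectors,
-- and all vectors when k is odd; either way H contains every difference of
-- two vertices of the component, so A = V, contradicting |A| ≤ |V|/2.  A
-- single vertex has exactly C(d,k) cut edges.

open import Defs
open import Algebra.Bundles using (CommutativeRing)
open import Data.Bool using (Bool; true; false; not; _∧_; _xor_; if_then_else_)
open import Data.Bool.Properties
  using ( xor-assoc; xor-comm; xor-identityˡ; xor-identityʳ; xor-same; not-injective; not-involutive
        ; not-distribˡ-xor; ∧-conicalˡ; ∧-conicalʳ; T-≡; xor-∧-commutativeRing )
  renaming (_≟_ to _≟B_)
open import Algebra.Properties.CommutativeSemigroup (CommutativeRing.+-commutativeSemigroup xor-∧-commutativeRing) using (interchange)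
open import Data.Empty using (⊥-elim)
open import Data.List using (List; []; _∷_; map; filter; length; _++_; concatMap; cartesianProduct)
open import Data.List.Membership.Propositional using (_∈_; lose)
open import Data.List.Membership.Propositional.Properties
  using (∈-filter⁺; ∈-filter⁻; ∈-map⁺; ∈-map⁻; ∈-++⁺ˡ; ∈-++⁺ʳ; ∈-cartesianProduct⁺; ∈-cartesianProduct⁻)
open import Data.List.Properties using (filter-++; length-++; length-map; filter-none; filter-≐; length-removeAt′)
open import Data.List.Relation.Unary.All as All using (All)
open import Data.List.Relation.Unary.Any as Any using (here; there; _─_; index)
open import Data.List.Relation.Unary.Any.Properties using (lookup-result)
open import Data.List.Relation.Unary.AllPairs using ([]; _∷_)
open import Data.List.Relation.Unary.Unique.Propositional using (Unique)
import Data.List.Relation.Unary.Unique.Propositional.Properties as Unique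
open import Data.Nat using (ℕ; zero; suc; _+_; _*_; _%_; _≟_; _≤_; z≤n; s≤s)
open import Data.Nat.Combinatorics using (_C_; nCk+nC[k+1]≡[n+1]C[k+1])
open import Data.Nat.DivMod using (%-distribˡ-+)
open import Data.Nat.Properties
  using ( ≤-trans; ≤-antisym; ≤-pred; ≤-reflexive; <⇒≤; <⇒≢; <⇒≱; m≤n⇒m≤1+n; n≢0⇒n>0; +-identityʳ; +-suc; +-comm
        ; +-monoʳ-≤; *-monoʳ-≤; m≤m*n; m≤m+n; m<m+n; suc-injective; ≡ᵇ⇒≡; ≡⇒≡ᵇ; module ≤-Reasoning )
open import Data.Product using (Σ; ∃; _×_; _,_; proj₁; proj₂)
open import Data.Sum using (_⊎_; inj₁; inj₂; [_,_]′)
open import Data.Vec using ([]; _∷_; zipWith; replicate)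
open import Data.Vec.Properties using (zipWith-assoc; zipWith-comm; zipWith-identityˡ; zipWith-identityʳ; ∷-injectiveʳ)
  renaming (≡-dec to ≡-decᵛ)
open import Function using (_∘_; id; case_of_; Equivalence)
open import Level using (Level)
open import Relation.Binary.Definitions using (DecidableEquality)
open import Relation.Binary.PropositionalEquality
  using (_≡_; _≢_; refl; sym; trans; cong; cong₂; subst; module ≡-Reasoning)
open import Relation.Nullary using (¬_; Dec; yes; no; does; map′)
open import Relation.Nullary.Decidable using (dec-true; dec-false; decidable-stable; _×-dec_)
open import Relation.Unary using (Decidable)
open import Relation.Unary.Properties using (∁?)

private
  variable
    a b ℓ : Level
    d k : ℕ

module _ {A : Set a} {B : Set b} where

  ∈-─ : ∀ {x y} {ys : List B} (x∈ys : x ∈ ys) → y ∈ ys → x ≢ y → y ∈ (ys ─ x∈ys)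
  ∈-─ (here refl) (here refl) x≢y = ⊥-elim (x≢y refl)
  ∈-─ (here _)    (there y∈)  _   = y∈
  ∈-─ (there _)   (here y≡)   _   = here y≡
  ∈-─ (there x∈)  (there y∈)  x≢y = there (∈-─ x∈ y∈ x≢y)

  length-≤-injection : (f : A → B) {xs : List A} {ys : List B} → Unique xs →
    (∀ {x} → x ∈ xs → f x ∈ ys) → (∀ {x y} → x ∈ xs → y ∈ xs → f x ≡ f y → x ≡ y) →
    length xs ≤ length ys
  length-≤-injection f {[]} _ _ _ = z≤n
  length-≤-injection f {x ∷ xs} {ys} (x∉xs ∷ xs-unique) f∈ f-inj = begin
    suc (length xs)            ≤⟨ s≤s (length-≤-injection f xs-unique f∈′ f-inj′) ⟩
    suc (length (ys ─ fx∈ys))  ≡⟨ length-removeAt′ ys (index fx∈ys) ⟨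
    length ys                  ∎
    where
    open ≤-Reasoning
    fx∈ys : f x ∈ ys
    fx∈ys = f∈ (here refl)
    f∈′ : ∀ {y} → y ∈ xs → f y ∈ (ys ─ fx∈ys)
    f∈′ y∈ = ∈-─ fx∈ys (f∈ (there y∈)) (λ fx≡fy → All.lookup x∉xs y∈ (f-inj (here refl) (there y∈) fx≡fy))
    f-inj′ : ∀ {y z} → y ∈ xs → z ∈ xs → f y ≡ f z → y ≡ z
    f-inj′ y∈ z∈ = f-inj (there y∈) (there z∈)

module _ {A : Set a} where

  length-≤-⊆ : {xs ys : List A} → Unique xs → (∀ {x} → x ∈ xs → x ∈ ys) → length xs ≤ length ys
  length-≤-⊆ xs-unique xs⊆ys = length-≤-injection id xs-unique xs⊆ys (λ _ _ x≡y → x≡y)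

  ∈⇒length≢0 : ∀ {x} {xs : List A} → x ∈ xs → length xs ≢ 0
  ∈⇒length≢0 (here _)  ()
  ∈⇒length≢0 (there _) ()

  1≤length⇒∃∈ : (xs : List A) → 1 ≤ length xs → ∃ λ x → x ∈ xs
  1≤length⇒∃∈ (x ∷ _) _ = x , here refl

  filter+filter-∁≡length : {P : A → Set ℓ} (P? : Decidable P) (xs : List A) →
    length (filter P? xs) + length (filter (∁? P?) xs) ≡ length xs
  filter+filter-∁≡length P? [] = refl
  filter+filter-∁≡length P? (x ∷ xs) with does (P? x)
  ... | true  = cong suc (filter+filter-∁≡length P? xs)
  ... | false = trans (+-suc _ _) (cong suc (filter+filter-∁≡length P? xs))

  length-filter-map : ∀ {C : Set b} {P : C → Set ℓ} (P? : Decidable P) (f : A → C) (xs : List A) →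
    length (filter P? (map f xs)) ≡ length (filter (P? ∘ f) xs)
  length-filter-map P? f [] = refl
  length-filter-map P? f (x ∷ xs) with does (P? (f x))
  ... | true  = cong suc (length-filter-map P? f xs)
  ... | false = length-filter-map P? f xs

concatMap-map-,≡cartesianProduct : {A : Set a} {B : Set b} (xs : List A) (ys : List B) →
  concatMap (λ x → map (λ y → (x , y)) ys) xs ≡ cartesianProduct xs ys
concatMap-map-,≡cartesianProduct [] ys = refl
concatMap-map-,≡cartesianProduct (x ∷ xs) ys = cong (map (x ,_) ys ++_) (concatMap-map-,≡cartesianProduct xs ys)

infixl 6 _⊕_
_⊕_ : Vertex d → Vertex d → Vertex d
_⊕_ = zipWith _xor_

𝟘 : Vertex d
𝟘 {d} = replicate d false

_≟ᵛ_ : DecidableEquality (Vertex d)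
_≟ᵛ_ = ≡-decᵛ _≟B_

⊕-assoc : (x y z : Vertex d) → (x ⊕ y) ⊕ z ≡ x ⊕ (y ⊕ z)
⊕-assoc = zipWith-assoc xor-assoc

⊕-comm : (x y : Vertex d) → x ⊕ y ≡ y ⊕ x
⊕-comm = zipWith-comm xor-comm

⊕-identityˡ : (x : Vertex d) → 𝟘 ⊕ x ≡ x
⊕-identityˡ = zipWith-identityˡ xor-identityˡ

⊕-identityʳ : (x : Vertex d) → x ⊕ 𝟘 ≡ x
⊕-identityʳ = zipWith-identityʳ xor-identityʳ

⊕-self : (x : Vertex d) → x ⊕ x ≡ 𝟘
⊕-self []       = refl
⊕-self (b ∷ x) = cong₂ _∷_ (xor-same b) (⊕-self x)

⊕-cancelˡ : (x y : Vertex d) → x ⊕ (x ⊕ y) ≡ y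
⊕-cancelˡ x y = begin
  x ⊕ (x ⊕ y)  ≡⟨ ⊕-assoc x x y ⟨
  (x ⊕ x) ⊕ y  ≡⟨ cong (_⊕ y) (⊕-self x) ⟩
  𝟘 ⊕ y        ≡⟨ ⊕-identityˡ y ⟩
  y            ∎
  where open ≡-Reasoning

⊕-cancelʳ : (x y : Vertex d) → (x ⊕ y) ⊕ y ≡ x
⊕-cancelʳ x y = trans (⊕-assoc x y y) (trans (cong (x ⊕_) (⊕-self y)) (⊕-identityʳ x))

⊕-injectiveˡ : (x : Vertex d) {y z : Vertex d} → x ⊕ y ≡ x ⊕ z → y ≡ z
⊕-injectiveˡ x {y} {z} eq = trans (sym (⊕-cancelˡ x y)) (trans (cong (x ⊕_) eq) (⊕-cancelˡ x z))

x⊕y≡x⇒y≡𝟘 : (x y : Vertex d) → x ⊕ y ≡ x → y ≡ 𝟘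
x⊕y≡x⇒y≡𝟘 x y eq = ⊕-injectiveˡ x (trans eq (sym (⊕-identityʳ x)))

⊕-swapʳ : (x y z : Vertex d) → (x ⊕ y) ⊕ z ≡ (x ⊕ z) ⊕ y
⊕-swapʳ x y z = trans (⊕-assoc x y z) (trans (cong (x ⊕_) (⊕-comm y z)) (sym (⊕-assoc x z y)))

∈-allVertices : (v : Vertex d) → v ∈ allVertices d
∈-allVertices []            = here refl
∈-allVertices {suc d} (true ∷ v)  = ∈-++⁺ˡ (∈-map⁺ (true ∷_) (∈-allVertices v))
∈-allVertices {suc d} (false ∷ v) = ∈-++⁺ʳ (map (true ∷_) (allVertices d)) (∈-map⁺ (false ∷_) (∈-allVertices v))

allVertices-unique : (d : ℕ) → Unique (allVertices d)
allVertices-unique zero    = All.[] ∷ []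
allVertices-unique (suc d) =
  Unique.++⁺ (Unique.map⁺ ∷-injectiveʳ (allVertices-unique d)) (Unique.map⁺ ∷-injectiveʳ (allVertices-unique d)) disjoint
  where
  disjoint : ∀ {v} → ¬ (v ∈ map (true ∷_) (allVertices d) × v ∈ map (false ∷_) (allVertices d))
  disjoint (∈ᵗ , ∈ᶠ) with ∈-map⁻ (true ∷_) ∈ᵗ | ∈-map⁻ (false ∷_) ∈ᶠ
  ... | _ , _ , refl | _ , _ , ()

∀-vertex? : {P : Vertex d → Set ℓ} → Decidable P → Dec (∀ v → P v)
∀-vertex? {d} P? =
  map′ (λ all v → All.lookup all (∈-allVertices v)) (λ ∀P → All.tabulate (λ {v} _ → ∀P v)) (All.all? P? (allVertices d))

members : Subset d → List (Vertex d)
members {d} S = filter (λ v → S v ≟B true) (allVertices d)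

members-unique : (S : Subset d) → Unique (members S)
members-unique {d} S = Unique.filter⁺ (λ v → S v ≟B true) (allVertices-unique d)

∈-members⁺ : (S : Subset d) {v : Vertex d} → S v ≡ true → v ∈ members S
∈-members⁺ S {v} = ∈-filter⁺ (λ v → S v ≟B true) (∈-allVertices v)

∈-members⁻ : (S : Subset d) {v : Vertex d} → v ∈ members S → S v ≡ true
∈-members⁻ {d} S = proj₂ ∘ ∈-filter⁻ (λ v → S v ≟B true) {xs = allVertices d}

⊆⇒size≤ : {S T : Subset d} → S ⊆ T → size S ≤ size T
⊆⇒size≤ {S = S} {T} S⊆T = length-≤-⊆ (members-unique S) (λ v∈ → ∈-members⁺ T (S⊆T _ (∈-members⁻ S v∈)))

1≤size⇒∃ : (S : Subset d) → 1 ≤ size S → Σ (Vertex d) λ v → S v ≡ true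
1≤size⇒∃ S 1≤|S| with v , v∈ ← 1≤length⇒∃∈ (members S) 1≤|S| = v , ∈-members⁻ S v∈

2≤size : (S : Subset d) {u v : Vertex d} → u ≢ v → S u ≡ true → S v ≡ true → 2 ≤ size S
2≤size S u≢v Su Sv = length-≤-⊆ ((u≢v All.∷ All.[]) ∷ All.[] ∷ [])
  λ { (here refl) → ∈-members⁺ S Su ; (there (here refl)) → ∈-members⁺ S Sv }

weight : Vertex d → ℕ
weight []      = 0
weight (b ∷ v) = (if b then 1 else 0) + weight v

weight-𝟘 : (d : ℕ) → weight (𝟘 {d}) ≡ 0
weight-𝟘 zero    = refl
weight-𝟘 (suc d) = weight-𝟘 d

weight≤dimension : (v : Vertex d) → weight v ≤ d
weight≤dimension []          = z≤n
weight≤dimension (true ∷ v)  = s≤s (weight≤dimension v)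
weight≤dimension (false ∷ v) = m≤n⇒m≤1+n (weight≤dimension v)

hamming≡weight-⊕ : (u v : Vertex d) → hamming u v ≡ weight (u ⊕ v)
hamming≡weight-⊕ []      []      = refl
hamming≡weight-⊕ (x ∷ u) (y ∷ v) = cong ((if x xor y then 1 else 0) +_) (hamming≡weight-⊕ u v)

hamming-⊕ʳ : (x s : Vertex d) → hamming x (x ⊕ s) ≡ weight s
hamming-⊕ʳ x s = trans (hamming≡weight-⊕ x (x ⊕ s)) (cong weight (⊕-cancelˡ x s))

m+1+n≤1+o⇒m+n≤o : ∀ {m n o} → m + suc n ≤ suc o → m + n ≤ o
m+1+n≤1+o⇒m+n≤o {m} {n} {o} = ≤-pred ∘ subst (_≤ suc o) (+-suc m n)

-- s takes i of the ones of t and m further ones outside t, so s ⊕ t keeps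
-- the other j ones of t together with those m.
∃-weight-distance : (t : Vertex d) (i j m : ℕ) → i + j ≡ weight t → m + weight t ≤ d →
  Σ (Vertex d) λ s → weight s ≡ i + m × weight (s ⊕ t) ≡ j + m
∃-weight-distance []          zero    zero    zero    refl z≤n = [] , refl , refl
∃-weight-distance (true ∷ t)  (suc i) j       m       eq   m+w≤d
  with s , ws , wst ← ∃-weight-distance t i j m (suc-injective eq) (m+1+n≤1+o⇒m+n≤o m+w≤d)
  = true ∷ s , cong suc ws , wst
∃-weight-distance (true ∷ t)  zero    (suc j) m       eq   m+w≤d
  with s , ws , wst ← ∃-weight-distance t zero j m (suc-injective eq) (m+1+n≤1+o⇒m+n≤o m+w≤d)
  = false ∷ s , ws , cong suc wst
∃-weight-distance (false ∷ t) i       j       (suc m) eq   (s≤s m+w≤d)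
  with s , ws , wst ← ∃-weight-distance t i j m eq m+w≤d
  = true ∷ s , trans (cong suc ws) (sym (+-suc i m)) , trans (cong suc wst) (sym (+-suc j m))
∃-weight-distance (false ∷ t) i       j       zero    eq   _
  with s , ws , wst ← ∃-weight-distance t i j zero eq (weight≤dimension t)
  = false ∷ s , ws , wst

∃-weight : (m : ℕ) → m ≤ d → Σ (Vertex d) λ s → weight s ≡ m
∃-weight {d} m m≤d
  with s , ws , _ ← ∃-weight-distance 𝟘 0 0 m (sym (weight-𝟘 d))
                      (subst (λ w → m + w ≤ d) (sym (weight-𝟘 d)) (subst (_≤ d) (sym (+-identityʳ m)) m≤d))
  = s , ws

parity-⊕ : (u v : Vertex d) → parity (u ⊕ v) ≡ parity u xor parity v
parity-⊕ []      []      = refl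
parity-⊕ (x ∷ u) (y ∷ v) = trans (cong ((x xor y) xor_) (parity-⊕ u v)) (interchange x y (parity u) (parity v))

parity-𝟘 : (d : ℕ) → parity (𝟘 {d}) ≡ false
parity-𝟘 zero    = refl
parity-𝟘 (suc d) = parity-𝟘 d

parity-weight : (v : Vertex d) → (if parity v then 1 else 0) ≡ weight v % 2
parity-weight []          = refl
parity-weight (false ∷ v) = parity-weight v
parity-weight (true ∷ v)  = begin
  (if not (parity v) then 1 else 0)     ≡⟨ flip (parity v) ⟩
  (1 + (if parity v then 1 else 0)) % 2 ≡⟨ cong (λ n → (1 + n) % 2) (parity-weight v) ⟩
  (1 + weight v % 2) % 2                ≡⟨ %-distribˡ-+ 1 (weight v) 2 ⟨
  suc (weight v) % 2                    ∎
  where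
  open ≡-Reasoning
  flip : ∀ p → (if not p then 1 else 0) ≡ (1 + (if p then 1 else 0)) % 2
  flip true  = refl
  flip false = refl

even-weight⇒parity-false : (v : Vertex d) → weight v % 2 ≡ 0 → parity v ≡ false
even-weight⇒parity-false v even with parity v | parity-weight v
... | false | _   = refl
... | true  | 1≡w = case trans 1≡w even of λ ()

odd-weight⇒parity-true : (v : Vertex d) → weight v % 2 ≡ 1 → parity v ≡ true
odd-weight⇒parity-true v odd with parity v | parity-weight v
... | true  | _   = refl
... | false | 0≡w = case trans 0≡w odd of λ ()

⊕-Closed : (Vertex d → Set ℓ) → Set ℓ
⊕-Closed G = ∀ {x y} → G x → G y → G (x ⊕ y)

weight-k-generate-weight-2 : (G : Vertex d → Set ℓ) → ⊕-Closed G → 1 ≤ k → suc k ≤ d →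
  (∀ s → weight s ≡ k → G s) → ∀ t → weight t ≡ 2 → G t
weight-k-generate-weight-2 {d} {k = suc k} G G⊕ _ k<d Gk t wt≡2
  with s , ws , ws⊕t ← ∃-weight-distance t 1 1 k (sym wt≡2)
                         (subst (λ w → k + w ≤ d) (sym wt≡2) (subst (_≤ d) (+-comm 2 k) k<d))
  = subst G (⊕-cancelˡ s t) (G⊕ (Gk s ws) (Gk (s ⊕ t) ws⊕t))

weight-2-generate-even : (G : Vertex d → Set ℓ) → ⊕-Closed G → G 𝟘 → (∀ t → weight t ≡ 2 → G t) →
  ∀ z → parity z ≡ false → G z
weight-2-generate-even         G G⊕ G𝟘 G₂ []          _ = G𝟘
weight-2-generate-even {suc d} G G⊕ G𝟘 G₂ (false ∷ z) even =
  weight-2-generate-even (G ∘ (false ∷_)) G⊕ G𝟘 (G₂ ∘ (false ∷_)) z even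
weight-2-generate-even {suc (suc d)} G G⊕ G𝟘 G₂ (true ∷ c ∷ z) even =
  subst G (cong (true ∷_) (cong₂ _∷_ (not-involutive c) (⊕-identityˡ z)))
    (G⊕ (G₂ (true ∷ true ∷ 𝟘) (cong (2 +_) (weight-𝟘 d)))
        (weight-2-generate-even (G ∘ (false ∷_)) G⊕ G𝟘 (G₂ ∘ (false ∷_)) (not c ∷ z)
          (trans (sym (not-distribˡ-xor c (parity z))) even)))

even-and-odd-generate-all : (G : Vertex d → Set ℓ) → ⊕-Closed G → (∀ z → parity z ≡ false → G z) →
  ∀ {s} → G s → parity s ≡ true → ∀ z → G z
even-and-odd-generate-all G G⊕ Geven {s} Gs odd z with parity z in pz
... | false = Geven z pz
... | true  = subst G (⊕-cancelˡ s z) (G⊕ Gs (Geven (s ⊕ z) (trans (parity-⊕ s z) (cong₂ _xor_ odd pz))))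

TranslationClosed : ℕ → Subset d → Set
TranslationClosed k V = ∀ {x s} → V x ≡ true → weight s ≡ k → V (x ⊕ s) ≡ true

parityClass : Bool → Bool → Bool
parityClass b p = if b then p else not p

parityClass-injective : ∀ b {p q} → parityClass b p ≡ true → parityClass b q ≡ true → p ≡ q
parityClass-injective true  p≡true q≡true = trans p≡true (sym q≡true)
parityClass-injective false p≡true q≡true = not-injective (trans p≡true (sym q≡true))

component-translationClosed : {V : Subset d} → IsComponent d k V → TranslationClosed k V
component-translationClosed (inj₁ (_ , V≡true)) _ _ = V≡true _
component-translationClosed {k = k} {V = V} (inj₂ (k-even , b , V≡)) {x} {s} Vx ws = begin
  V (x ⊕ s)                        ≡⟨ V≡ (x ⊕ s) ⟩
  parityClass b (parity (x ⊕ s))   ≡⟨ cong (parityClass b) (parity-⊕ x s) ⟩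
  parityClass b (parity x xor parity s) ≡⟨ cong (λ p → parityClass b (parity x xor p)) s-even ⟩
  parityClass b (parity x xor false)    ≡⟨ cong (parityClass b) (xor-identityʳ (parity x)) ⟩
  parityClass b (parity x)         ≡⟨ V≡ x ⟨
  V x                              ≡⟨ Vx ⟩
  true                             ∎
  where
  open ≡-Reasoning
  s-even : parity s ≡ false
  s-even = even-weight⇒parity-false s (trans (cong (_% 2) ws) k-even)

component-difference-even-or-k-odd : {V : Subset d} → IsComponent d k V → ∀ {u v} → V u ≡ true → V v ≡ true →
  parity (u ⊕ v) ≡ false ⊎ k % 2 ≡ 1
component-difference-even-or-k-odd (inj₁ (k-odd , _)) _ _ = inj₂ k-odd
component-difference-even-or-k-odd (inj₂ (_ , b , V≡)) {u} {v} Vu Vv = inj₁ (begin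
  parity (u ⊕ v)            ≡⟨ parity-⊕ u v ⟩
  parity u xor parity v     ≡⟨ cong (_xor parity v) (parityClass-injective b (trans (sym (V≡ u)) Vu)
                                                                              (trans (sym (V≡ v)) Vv)) ⟩
  parity v xor parity v     ≡⟨ xor-same (parity v) ⟩
  false                     ∎)
  where open ≡-Reasoning

component-nonempty : {V : Subset d} → 1 ≤ d → IsComponent d k V → Σ (Vertex d) λ u → V u ≡ true
component-nonempty _ (inj₁ (_ , V≡true)) = 𝟘 , V≡true 𝟘
component-nonempty {d} (s≤s _) (inj₂ (_ , false , V≡)) = 𝟘 , trans (V≡ 𝟘) (cong not (parity-𝟘 d))
component-nonempty {suc d} (s≤s _) (inj₂ (_ , true , V≡)) =
  true ∷ 𝟘 , trans (V≡ (true ∷ 𝟘)) (cong not (parity-𝟘 d))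

component-differences-generated : {V : Subset d} → IsComponent d k V → 1 ≤ k → suc k ≤ d →
  (G : Vertex d → Set ℓ) → ⊕-Closed G → G 𝟘 → (∀ s → weight s ≡ k → G s) →
  ∀ {u v} → V u ≡ true → V v ≡ true → G (u ⊕ v)
component-differences-generated {d} {k} comp 1≤k k<d G G⊕ G𝟘 Gk {u} {v} Vu Vv =
  [ Geven (u ⊕ v) , (λ k-odd → Gall k-odd (u ⊕ v)) ]′ (component-difference-even-or-k-odd {k = k} comp Vu Vv)
  where
  Geven : ∀ z → parity z ≡ false → G z
  Geven = weight-2-generate-even G G⊕ G𝟘 (weight-k-generate-weight-2 G G⊕ 1≤k k<d Gk)
  Gall : k % 2 ≡ 1 → ∀ z → G z
  Gall k-odd with s , ws ← ∃-weight k (<⇒≤ k<d)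
    = even-and-odd-generate-all G G⊕ Geven (Gk s ws) (odd-weight⇒parity-true s (trans (cong (_% 2) ws) k-odd))

Stabilises : Subset d → Vertex d → Set
Stabilises A h = ∀ x → A (x ⊕ h) ≡ A x

stabilises? : (A : Subset d) → Decidable (Stabilises A)
stabilises? A h = ∀-vertex? (λ x → A (x ⊕ h) ≟B A x)

stabilises-𝟘 : (A : Subset d) → Stabilises A 𝟘
stabilises-𝟘 A x = cong A (⊕-identityʳ x)

stabilises-⊕ : (A : Subset d) → ⊕-Closed (Stabilises A)
stabilises-⊕ A {g} {h} Ag Ah x = begin
  A (x ⊕ (g ⊕ h))  ≡⟨ cong A (⊕-assoc x g h) ⟨
  A ((x ⊕ g) ⊕ h)  ≡⟨ Ah (x ⊕ g) ⟩
  A (x ⊕ g)        ≡⟨ Ag x ⟩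
  A x              ∎
  where open ≡-Reasoning

Leaves : Subset d → Vertex d → Vertex d → Set
Leaves A s x = A x ≡ true × A (x ⊕ s) ≡ false

leaves? : (A : Subset d) (s : Vertex d) → Decidable (Leaves A s)
leaves? A s x = (A x ≟B true) ×-dec (A (x ⊕ s) ≟B false)

¬leaves⇒stabilises : (A : Subset d) (s : Vertex d) → (∀ x → ¬ Leaves A s x) → Stabilises A s
¬leaves⇒stabilises A s ¬leaves x with A x in Ax | A (x ⊕ s) in Ax⊕s
... | true  | true  = refl
... | false | false = refl
... | true  | false = ⊥-elim (¬leaves x (Ax , Ax⊕s))
... | false | true  = ⊥-elim (¬leaves (x ⊕ s) (Ax⊕s , trans (cong A (⊕-cancelʳ x s)) Ax))

-- Junk value 𝟘 when s stabilises A, where no boundary point exists.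
boundaryPoint : Subset d → Vertex d → Vertex d
boundaryPoint {d} A s with Any.any? (leaves? A s) (allVertices d)
... | yes x∈ = Any.lookup x∈
... | no _   = 𝟘

boundaryPoint-leaves : (A : Subset d) (s : Vertex d) → ¬ Stabilises A s → Leaves A s (boundaryPoint A s)
boundaryPoint-leaves {d} A s ¬stable with Any.any? (leaves? A s) (allVertices d)
... | yes x∈ = lookup-result x∈
... | no ∄x  = ⊥-elim (¬stable (¬leaves⇒stabilises A s (λ x leaves → ∄x (lose (∈-allVertices x) leaves))))

isCutEdge : ℕ → (V A : Subset d) → Vertex d × Vertex d → Bool
isCutEdge k V A (u , v) = A u ∧ (V v ∧ (not (A v) ∧ adjᵇ k u v))

cutEdges : ℕ → (V A : Subset d) → List (Vertex d × Vertex d)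
cutEdges {d} k V A = filter (λ e → isCutEdge k V A e ≟B true) (cartesianProduct (allVertices d) (allVertices d))

cutSize≡length-cutEdges : (k : ℕ) (V A : Subset d) → cutSize k V A ≡ length (cutEdges k V A)
cutSize≡length-cutEdges {d} k V A =
  cong (length ∘ filter (λ e → isCutEdge k V A e ≟B true)) (concatMap-map-,≡cartesianProduct (allVertices d) (allVertices d))

∈-cutEdges⁺ : (V A : Subset d) {u v : Vertex d} → A u ≡ true → V v ≡ true → A v ≡ false → hamming u v ≡ k →
  (u , v) ∈ cutEdges k V A
∈-cutEdges⁺ {k = k} V A {u} {v} Au Vv Av huv =
  ∈-filter⁺ (λ e → isCutEdge k V A e ≟B true) (∈-cartesianProduct⁺ (∈-allVertices u) (∈-allVertices v)) cut
  where
  cut : isCutEdge k V A (u , v) ≡ true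
  cut rewrite Au | Vv | Av | huv = Equivalence.to T-≡ (≡⇒≡ᵇ k k refl)

∈-cutEdges⁻ : (V A : Subset d) {u v : Vertex d} → (u , v) ∈ cutEdges k V A → A u ≡ true × hamming u v ≡ k
∈-cutEdges⁻ {d} {k} V A {u} {v} uv∈ = ∧-conicalˡ _ _ cut , ≡ᵇ⇒≡ _ _ (Equivalence.from T-≡ adj)
  where
  cut : isCutEdge k V A (u , v) ≡ true
  cut = proj₂ (∈-filter⁻ (λ e → isCutEdge k V A e ≟B true) {xs = cartesianProduct (allVertices d) (allVertices d)} uv∈)
  adj : adjᵇ k u v ≡ true
  adj = ∧-conicalʳ (not (A v)) _ (∧-conicalʳ (V v) _ (∧-conicalʳ (A u) _ cut))

leaves⇒cutEdge : {V A : Subset d} → A ⊆ V → TranslationClosed k V → ∀ {s x} → weight s ≡ k → Leaves A s x →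
  (x , x ⊕ s) ∈ cutEdges k V A
leaves⇒cutEdge {V = V} {A} A⊆V V-closed {s} {x} ws (Ax , Ax⊕s) =
  ∈-cutEdges⁺ V A Ax (V-closed (A⊆V x Ax) ws) Ax⊕s (trans (hamming-⊕ʳ x s) ws)

length-cartesianProduct : {A : Set a} {B : Set b} (xs : List A) (ys : List B) →
  length (cartesianProduct xs ys) ≡ length xs * length ys
length-cartesianProduct []       ys = refl
length-cartesianProduct (x ∷ xs) ys =
  trans (length-++ (map (x ,_) ys)) (cong₂ _+_ (length-map (x ,_) ys) (length-cartesianProduct xs ys))

length-filter-allVertices : {P : Vertex (suc d) → Set ℓ} (P? : Decidable P) →
  length (filter P? (allVertices (suc d)))
    ≡ length (filter (P? ∘ (true ∷_)) (allVertices d)) + length (filter (P? ∘ (false ∷_)) (allVertices d))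
length-filter-allVertices {d} P? = begin
  length (filter P? (map (true ∷_) vs ++ map (false ∷_) vs))
    ≡⟨ cong length (filter-++ P? (map (true ∷_) vs) (map (false ∷_) vs)) ⟩
  length (filter P? (map (true ∷_) vs) ++ filter P? (map (false ∷_) vs))
    ≡⟨ length-++ (filter P? (map (true ∷_) vs)) ⟩
  length (filter P? (map (true ∷_) vs)) + length (filter P? (map (false ∷_) vs))
    ≡⟨ cong₂ _+_ (length-filter-map P? (true ∷_) vs) (length-filter-map P? (false ∷_) vs) ⟩
  length (filter (P? ∘ (true ∷_)) vs) + length (filter (P? ∘ (false ∷_)) vs)
    ∎
  where
  open ≡-Reasoning
  vs : List (Vertex d)
  vs = allVertices d

withWeight : (d k : ℕ) → List (Vertex d)
withWeight d k = filter (λ v → weight v ≟ k) (allVertices d)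

∈-withWeight⁺ : {s : Vertex d} → weight s ≡ k → s ∈ withWeight d k
∈-withWeight⁺ {k = k} {s} = ∈-filter⁺ (λ v → weight v ≟ k) (∈-allVertices s)

∈-withWeight⁻ : {s : Vertex d} → s ∈ withWeight d k → weight s ≡ k
∈-withWeight⁻ {d} {k} = proj₂ ∘ ∈-filter⁻ (λ v → weight v ≟ k) {xs = allVertices d}

length-withWeight : (d k : ℕ) → length (withWeight d k) ≡ d C k
length-withWeight zero    zero    = refl
length-withWeight zero    (suc k) = refl
length-withWeight (suc d) zero    = trans (length-filter-allVertices {d} (λ v → weight v ≟ 0))
  (cong₂ _+_ (cong length (filter-none (λ v → suc (weight v) ≟ 0) {allVertices d} (All.tabulate (λ _ ()))))
             (length-withWeight d zero))
length-withWeight (suc d) (suc k) = begin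
  length (withWeight (suc d) (suc k))
    ≡⟨ length-filter-allVertices {d} (λ v → weight v ≟ suc k) ⟩
  length (filter (λ v → suc (weight v) ≟ suc k) (allVertices d)) + length (withWeight d (suc k))
    ≡⟨ cong (λ n → length n + length (withWeight d (suc k)))
         (filter-≐ (λ v → suc (weight v) ≟ suc k) (λ v → weight v ≟ k) (suc-injective , cong suc) (allVertices d)) ⟩
  length (withWeight d k) + length (withWeight d (suc k))
    ≡⟨ cong₂ _+_ (length-withWeight d k) (length-withWeight d (suc k)) ⟩
  d C k + d C suc k
    ≡⟨ nCk+nC[k+1]≡[n+1]C[k+1] d k ⟩
  suc d C suc k
    ∎
  where open ≡-Reasoning

module StabiliserCount {d : ℕ} (k : ℕ) {V A : Subset d} (A⊆V : A ⊆ V) (V-closed : TranslationClosed k V) where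

  stabiliser : List (Vertex d)
  stabiliser = filter (stabilises? A) (allVertices d)

  stable : List (Vertex d)
  stable = filter (stabilises? A) (withWeight d k)

  unstable : List (Vertex d)
  unstable = filter (∁? (stabilises? A)) (withWeight d k)

  stable+unstable≡C : length stable + length unstable ≡ d C k
  stable+unstable≡C = trans (filter+filter-∁≡length (stabilises? A) (withWeight d k)) (length-withWeight d k)

  ∈-stable⁻ : ∀ {s} → s ∈ stable → weight s ≡ k × Stabilises A s
  ∈-stable⁻ s∈ = let s∈K , stable-s = ∈-filter⁻ (stabilises? A) {xs = withWeight d k} s∈ in
    ∈-withWeight⁻ s∈K , stable-s

  1+stable≤stabiliser : 1 ≤ k → suc (length stable) ≤ length stabiliser
  1+stable≤stabiliser 1≤k =
    length-≤-⊆ (𝟘∉stable ∷ Unique.filter⁺ _ (Unique.filter⁺ _ (allVertices-unique d))) ⊆stabiliser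
    where
    𝟘∉stable : All (𝟘 ≢_) stable
    𝟘∉stable = All.tabulate λ s∈ 𝟘≡s →
      <⇒≢ 1≤k (trans (sym (weight-𝟘 d)) (trans (cong weight 𝟘≡s) (proj₁ (∈-stable⁻ s∈))))
    ⊆stabiliser : ∀ {x} → x ∈ 𝟘 ∷ stable → x ∈ stabiliser
    ⊆stabiliser (here refl) = ∈-filter⁺ (stabilises? A) (∈-allVertices 𝟘) (stabilises-𝟘 A)
    ⊆stabiliser (there s∈)  = ∈-filter⁺ (stabilises? A) (∈-allVertices _) (proj₂ (∈-stable⁻ s∈))

  ∈-unstable⁻ : ∀ {s} → s ∈ unstable → weight s ≡ k × ¬ Stabilises A s
  ∈-unstable⁻ s∈ = let s∈K , unstable-s = ∈-filter⁻ (∁? (stabilises? A)) {xs = withWeight d k} s∈ in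
    ∈-withWeight⁻ s∈K , unstable-s

  ∈-stabiliser⁻ : ∀ {h} → h ∈ stabiliser → Stabilises A h
  ∈-stabiliser⁻ = proj₂ ∘ ∈-filter⁻ (stabilises? A) {xs = allVertices d}

  translate : Vertex d × Vertex d → Vertex d × Vertex d
  translate (s , h) = boundaryPoint A s ⊕ h , (boundaryPoint A s ⊕ h) ⊕ s

  translate-cutEdge : ∀ {s h} → s ∈ unstable → h ∈ stabiliser → translate (s , h) ∈ cutEdges k V A
  translate-cutEdge {s} {h} s∈ h∈ = leaves⇒cutEdge {V = V} {A} A⊆V V-closed ws (Ax⊕h , Ax⊕h⊕s)
    where
    x : Vertex d
    x = boundaryPoint A s
    ws : weight s ≡ k
    ws = proj₁ (∈-unstable⁻ s∈)
    Ax⊕h : A (x ⊕ h) ≡ true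
    Ax⊕h = trans (∈-stabiliser⁻ h∈ x) (proj₁ (boundaryPoint-leaves A s (proj₂ (∈-unstable⁻ s∈))))
    Ax⊕h⊕s : A ((x ⊕ h) ⊕ s) ≡ false
    Ax⊕h⊕s = trans (cong A (⊕-swapʳ x h s))
      (trans (∈-stabiliser⁻ h∈ (x ⊕ s)) (proj₂ (boundaryPoint-leaves A s (proj₂ (∈-unstable⁻ s∈)))))

  translate-injective : ∀ {p q} → translate p ≡ translate q → p ≡ q
  translate-injective {s , h} {s′ , h′} eq
    with refl ← ⊕-injectiveˡ _ (trans (cong proj₂ eq) (cong (_⊕ s′) (sym (cong proj₁ eq))))
    = cong (s ,_) (⊕-injectiveˡ (boundaryPoint A s) (cong proj₁ eq))

  unstable*stabiliser≤cut : length unstable * length stabiliser ≤ length (cutEdges k V A)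
  unstable*stabiliser≤cut = subst (_≤ length (cutEdges k V A)) (length-cartesianProduct unstable stabiliser)
    (length-≤-injection translate
      (Unique.cartesianProduct⁺ (Unique.filter⁺ _ (Unique.filter⁺ _ (allVertices-unique d)))
                                (Unique.filter⁺ _ (allVertices-unique d)))
      (λ sh∈ → let s∈ , h∈ = ∈-cartesianProduct⁻ unstable stabiliser sh∈ in translate-cutEdge s∈ h∈)
      (λ _ _ → translate-injective))

m+n≤n*[1+m] : (m : ℕ) {n : ℕ} → 1 ≤ n → m + n ≤ n * suc m
m+n≤n*[1+m] m {suc n} _ = begin
  m + suc n            ≡⟨ +-suc m n ⟩
  suc (m + n)          ≤⟨ s≤s (+-monoʳ-≤ m (m≤m*n n (suc m))) ⟩
  suc (m + n * suc m)  ∎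
  where open ≤-Reasoning

2*n≰n : {n : ℕ} → 1 ≤ n → ¬ (2 * n ≤ n)
2*n≰n {n} 1≤n = <⇒≱ (m<m+n n (≤-trans 1≤n (m≤m+n n 0)))

all-stable⇒V⊆A : {V A : Subset d} → IsComponent d k V → 1 ≤ k → suc k ≤ d → A ⊆ V →
  (∀ s → weight s ≡ k → Stabilises A s) → ∀ {u} → A u ≡ true → V ⊆ A
all-stable⇒V⊆A {V = V} {A} comp 1≤k k<d A⊆V all-stable {u} Au v Vv = begin
  A v              ≡⟨ cong A (⊕-cancelˡ u v) ⟨
  A (u ⊕ (u ⊕ v))  ≡⟨ component-differences-generated comp 1≤k k<d (Stabilises A) (stabilises-⊕ A) (stabilises-𝟘 A)
                        all-stable (A⊆V u Au) Vv u ⟩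
  A u              ≡⟨ Au ⟩
  true             ∎
  where open ≡-Reasoning

cutSize-lower-bound : {V A : Subset d} → IsComponent d k V → 1 ≤ k → suc k ≤ d → A ⊆ V →
  1 ≤ size A → 2 * size A ≤ size V → d C k ≤ cutSize k V A
cutSize-lower-bound {d} {k} {V} {A} comp 1≤k k<d A⊆V 1≤|A| balanced = begin
  d C k                                  ≡⟨ stable+unstable≡C ⟨
  length stable + length unstable        ≤⟨ m+n≤n*[1+m] (length stable) unstable-nonempty ⟩
  length unstable * suc (length stable)  ≤⟨ *-monoʳ-≤ (length unstable) (1+stable≤stabiliser 1≤k) ⟩
  length unstable * length stabiliser    ≤⟨ unstable*stabiliser≤cut ⟩
  length (cutEdges k V A)                ≡⟨ cutSize≡length-cutEdges k V A ⟨
  cutSize k V A                          ∎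
  where
  open ≤-Reasoning
  open StabiliserCount k A⊆V (component-translationClosed comp)
  all-stable : length unstable ≡ 0 → ∀ s → weight s ≡ k → Stabilises A s
  all-stable unstable≡0 s ws = decidable-stable (stabilises? A s) λ ¬stable →
    ∈⇒length≢0 (∈-filter⁺ (∁? (stabilises? A)) (∈-withWeight⁺ ws) ¬stable) unstable≡0
  |V|≤|A| : length unstable ≡ 0 → size V ≤ size A
  |V|≤|A| unstable≡0 with u , Au ← 1≤size⇒∃ A 1≤|A| =
    ⊆⇒size≤ (all-stable⇒V⊆A comp 1≤k k<d A⊆V (all-stable unstable≡0) Au)
  unstable-nonempty : 1 ≤ length unstable
  unstable-nonempty = n≢0⇒n>0 λ unstable≡0 → 2*n≰n 1≤|A| (≤-trans balanced (|V|≤|A| unstable≡0))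

singleton : Vertex d → Subset d
singleton u v = does (v ≟ᵛ u)

singleton-self : (u : Vertex d) → singleton u u ≡ true
singleton-self u = dec-true (u ≟ᵛ u) refl

singleton-other : {u v : Vertex d} → v ≢ u → singleton u v ≡ false
singleton-other {u = u} {v} = dec-false (v ≟ᵛ u)

singleton-sound : (u v : Vertex d) → singleton u v ≡ true → v ≡ u
singleton-sound u v with v ≟ᵛ u
... | yes v≡u = λ _ → v≡u
... | no _    = λ ()

size-singleton : (u : Vertex d) → size (singleton u) ≡ 1
size-singleton u = ≤-antisym
  (length-≤-⊆ {ys = u ∷ []} (members-unique (singleton u))
    (λ {v} v∈ → here (singleton-sound u v (∈-members⁻ (singleton u) v∈))))
  (length-≤-⊆ (All.[] ∷ []) λ { (here refl) → ∈-members⁺ (singleton u) {u} (singleton-self u) })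

x⊕s≢x : (x s : Vertex d) → 1 ≤ weight s → x ⊕ s ≢ x
x⊕s≢x {d} x s 1≤ws x⊕s≡x = <⇒≢ 1≤ws (trans (sym (weight-𝟘 d)) (cong weight (sym (x⊕y≡x⇒y≡𝟘 x s x⊕s≡x))))

cutSize-singleton : {V : Subset d} → TranslationClosed k V → 1 ≤ k → {u : Vertex d} → V u ≡ true →
  cutSize k V (singleton u) ≡ d C k
cutSize-singleton {d} {k} {V} V-closed 1≤k {u} Vu = begin
  cutSize k V (singleton u)           ≡⟨ cutSize≡length-cutEdges k V (singleton u) ⟩
  length (cutEdges k V (singleton u)) ≡⟨ ≤-antisym cut≤ cut≥ ⟩
  length (withWeight d k)             ≡⟨ length-withWeight d k ⟩
  d C k                               ∎
  where
  open ≡-Reasoning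
  u⊕s∉ : ∀ {s} → weight s ≡ k → singleton u (u ⊕ s) ≡ false
  u⊕s∉ {s} ws = singleton-other (x⊕s≢x u s (subst (1 ≤_) (sym ws) 1≤k))
  cut≥ : length (withWeight d k) ≤ length (cutEdges k V (singleton u))
  cut≥ = length-≤-injection (λ s → u , u ⊕ s) (Unique.filter⁺ _ (allVertices-unique d))
    (λ {s} s∈ → let ws = ∈-withWeight⁻ s∈ in
      ∈-cutEdges⁺ V (singleton u) (singleton-self u) (V-closed Vu ws) (u⊕s∉ ws) (trans (hamming-⊕ʳ u s) ws))
    (λ _ _ eq → ⊕-injectiveˡ u (cong proj₂ eq))
  cut≤ : length (cutEdges k V (singleton u)) ≤ length (withWeight d k)
  cut≤ = length-≤-injection (λ (x , y) → x ⊕ y)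
    (Unique.filter⁺ _ (Unique.cartesianProduct⁺ (allVertices-unique d) (allVertices-unique d)))
    (λ {(x , y)} xy∈ →
      ∈-withWeight⁺ (trans (sym (hamming≡weight-⊕ x y)) (proj₂ (∈-cutEdges⁻ V (singleton u) xy∈))))
    injective
    where
    injective : ∀ {p q} → p ∈ cutEdges k V (singleton u) → q ∈ cutEdges k V (singleton u) →
      proj₁ p ⊕ proj₂ p ≡ proj₁ q ⊕ proj₂ q → p ≡ q
    injective {x , y} {x′ , y′} p∈ q∈ eq
      with refl ← singleton-sound u x (proj₁ (∈-cutEdges⁻ V (singleton u) p∈))
         | refl ← singleton-sound u x′ (proj₁ (∈-cutEdges⁻ V (singleton u) q∈))
      = cong (u ,_) (⊕-injectiveˡ u eq)

singleton-attains : {V : Subset d} → IsComponent d k V → 1 ≤ k → suc k ≤ d →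
  Σ (Subset d) λ A → A ⊆ V × 1 ≤ size A × 2 * size A ≤ size V × cutSize k V A ≡ d C k
singleton-attains {d} {k} {V} comp 1≤k k<d
  with u , Vu ← component-nonempty {k = k} (≤-trans (s≤s z≤n) k<d) comp | s , ws ← ∃-weight k (<⇒≤ k<d)
  = singleton u , singleton⊆V , ≤-reflexive (sym (size-singleton u)) , balanced , cutSize-singleton V-closed 1≤k Vu
  where
  V-closed : TranslationClosed k V
  V-closed = component-translationClosed comp
  singleton⊆V : singleton u ⊆ V
  singleton⊆V v v≡u = subst (λ w → V w ≡ true) (sym (singleton-sound u v v≡u)) Vu
  balanced : 2 * size (singleton u) ≤ size V
  balanced = subst (λ n → 2 * n ≤ size V) (sym (size-singleton u))
    (2≤size V (λ u≡u⊕s → x⊕s≢x u s (subst (1 ≤_) (sym ws) 1≤k) (sym u≡u⊕s)) Vu (V-closed Vu ws))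

lemma16 : (k : ℕ) → 1 ≤ k → Σ ℕ λ d₀ → (d : ℕ) → d₀ ≤ d →
    (V : Subset d) → IsComponent d k V →
      (Σ (Subset d) λ A → A ⊆ V × 1 ≤ size A × 2 * size A ≤ size V × cutSize k V A ≡ d C k)
      × ((A : Subset d) → A ⊆ V → 1 ≤ size A → 2 * size A ≤ size V → d C k ≤ cutSize k V A)
lemma16 k 1≤k = suc k , λ d k<d V comp →
  singleton-attains comp 1≤k k<d , λ A A⊆V → cutSize-lower-bound comp 1≤k k<d A⊆V
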